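{- Let $n,k$ be integers with $1\le k\le n-2$ and $\gcd(n,k(k+1))=1$, and let $c\in\{1,\dots,n-1\}$ satisfy $c(k+1)\equiv1\pmod n$. Consider the cyclic word \[L=L_0L_1\cdots L_{n-1},\qquad L_j=E_{j(n-k-1)+1}\,E_{j(n-k-1)}^{ -1},\] in the formal letters $E_i,E_i^{ -1}$, $i\in\mathbb{Z}/n\mathbb{Z}$ (indices mod $n$; $E_0,E_0^{ -1}$ are kept as letters). Say that a letter lies between $E_i^{ -1}$ and $E_i$ if it is written between them after cyclically permuting $L$ so that $E_i^{ -1}$ is the leftmost letter. Then for each $0\le i<n$, the letters lying between $E_i^{ -1}$ and $E_i$ in $L$ are exactly \[\{E_{i+j(n-k-1)+1},\ E_{i+j(n-k-1)}^{ -1}\ :\ 1\le j\le c-1\}.\]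
   Context: In the paper $E_i$ denotes the loop $\epsilon^i\tau\cdot\tau^{ -1}$ on the curve $v^n=u(1-u)^k$, but the statement is purely about the ordering of letters in the word $L$. -}

module Defs where

open import Data.Bool using (Bool; true; false; if_then_else_)
open import Data.Nat using (ℕ; zero; suc; _+_; _*_; _∸_; _<_; _≡ᵇ_; NonZero)
open import Data.Nat.DivMod using (_%_; _/_)
open import Data.Product using (_×_; _,_; ∃)
open import Relation.Binary.PropositionalEquality using (_≡_)
open import Data.Nat.Properties using (m*n≢0)

-- A formal letter E_i^{±1}: (true , i) is E_i, (false , i) is E_i^{-1};
-- the index i is a natural number representing its class in ℤ/nℤ, always
-- normalised to the range 0 ≤ i < n (via _% n).
Letter : Set
Letter = Bool × ℕ

E : (n : ℕ) → .{{NonZero n}} → ℕ → Letter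
E n i = true , i % n

E⁻¹ : (n : ℕ) → .{{NonZero n}} → ℕ → Letter
E⁻¹ n i = false , i % n

-- The cyclic word L = L_0 L_1 ... L_{n-1}, L_j = E_{j(n-k-1)+1} E_{j(n-k-1)}^{-1},
-- of length 2n.  wordL n k m is the letter at position m (0 ≤ m < 2n):
-- position 2j carries E_{j(n-k-1)+1}, position 2j+1 carries E_{j(n-k-1)}^{-1}.
wordL : (n k : ℕ) → .{{NonZero n}} → ℕ → Letter
wordL n k m =
  if m % 2 ≡ᵇ 0
  then E n ((m / 2) * (n ∸ k ∸ 1) + 1)
  else E⁻¹ n ((m / 2) * (n ∸ k ∸ 1))

len : ℕ → ℕ
len n = 2 * n

-- Letter x lies (strictly) between positions p and q of the cyclic word
-- when the word is cyclically rotated so that position p is leftmost: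
-- x occurs at some position p + d (mod 2n) with 0 < d < (q - p mod 2n).
BetweenPos : (n k : ℕ) → .{{NonZero n}} → ℕ → ℕ → Letter → Set
BetweenPos n k p q x = let instance _ = m*n≢0 2 n in
  ∃ λ d → (0 < d) × (d < (q + len n ∸ p) % len n)
        × (wordL n k ((p + d) % len n) ≡ x)

module Submission where

open import Defs
open import Data.Bool using (true; false)
open import Data.Nat using (ℕ; zero; suc; pred; _+_; _*_; _∸_; _≤_; _<_; NonZero; nonZero; z≤n; s≤s)
open import Data.Nat.Properties
open import Data.Nat.DivMod
open import Data.Nat.Divisibility using (divides-refl)
open import Data.Nat.GCD using (gcd)
open import Data.Nat.Solver using (module +-*-Solver)
open import Data.Product using (_×_; ∃; _,_; proj₁; proj₂)
open import Data.Sum using (_⊎_; inj₁; inj₂)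
open import Function.Bundles using (_⇔_; mk⇔)
open import Relation.Binary.Bundles using (Setoid)
open import Relation.Binary.PropositionalEquality
open import Relation.Nullary using (contradiction)
import Relation.Binary.Construct.On as On
import Relation.Binary.Reasoning.Setoid as SetoidReasoning
open +-*-Solver

-- Write s = n − k − 1 ≡ −(k + 1) (mod n).  From c(k + 1) ≡ 1 we get cs ≡ −1, so s is invertible with
-- inverse n − c.  Hence E_i⁻¹ occurs exactly at the position 2a + 1 with as ≡ i, and E_i
-- exactly at the position 2b with bs + 1 ≡ i, which forces b ≡ a + c.  So E_i comes
-- 2c − 1 places after E_i⁻¹, and the letters in between, at positions 2(a + j) and
-- 2(a + j) + 1 for 1 ≤ j ≤ c − 1, are E_{i+js+1} and E_{i+js}⁻¹.

data EvenOdd : ℕ → Set where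
  even : ∀ t → EvenOdd (t * 2)
  odd  : ∀ t → EvenOdd (suc (t * 2))

evenOdd : ∀ d → EvenOdd d
evenOdd zero = even 0
evenOdd (suc d) with evenOdd d
... | even t = odd t
... | odd t  = even (suc t)

*2<suc*2⇒≤ : ∀ {m n} → m * 2 < suc (n * 2) → m ≤ n
*2<suc*2⇒≤ {m} {n} h = *-cancelʳ-≤ m n 2 (≤-pred h)

suc*2<suc*2⇒< : ∀ {m n} → suc (m * 2) < suc (n * 2) → m < n
suc*2<suc*2⇒< {m} {n} h = *-cancelʳ-< 2 m n (≤-pred h)

suc*2<*2⇒< : ∀ {m n} → suc (m * 2) < n * 2 → m < n
suc*2<*2⇒< {m} {n} h = *-cancelʳ-< 2 m n (<-trans (n<1+n (m * 2)) h)

suc[m*2]/2≡m : ∀ m → suc (m * 2) / 2 ≡ m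
suc[m*2]/2≡m m = trans (+-distrib-/-∣ʳ 1 {d = 2} (divides-refl m)) (m*n/n≡m m 2)

[m+n+o*p∸m]%p≡n : ∀ m n o p .{{_ : NonZero p}} → n < p → (m + n + o * p ∸ m) % p ≡ n
[m+n+o*p∸m]%p≡n m n o p n<p = begin
  (m + n + o * p ∸ m) % p     ≡⟨ cong (λ y → (y ∸ m) % p) (+-assoc m n (o * p)) ⟩
  (m + (n + o * p) ∸ m) % p   ≡⟨ cong (_% p) (m+n∸m≡n m (n + o * p)) ⟩
  (n + o * p) % p             ≡⟨ [m+kn]%n≡m%n n o p ⟩
  n % p                       ≡⟨ m<n⇒m%n≡m n<p ⟩
  n                           ∎
  where open ≡-Reasoning

module Modular (n : ℕ) .{{_ : NonZero n}} where

  infix 4 _≈_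
  _≈_ : ℕ → ℕ → Set
  a ≈ b = a % n ≡ b % n

  ≈-setoid : Setoid _ _
  ≈-setoid = On.setoid (setoid ℕ) (_% n)

  module ≈-Reasoning = SetoidReasoning ≈-setoid
  open ≈-Reasoning

  %-≈ : ∀ a → a % n ≈ a
  %-≈ a = m%n%n≡m%n a n

  *n≈0 : ∀ a → a * n ≈ 0
  *n≈0 a = trans (m*n%n≡0 a n) (sym (m*n%n≡0 0 n))

  +-congʳ : ∀ {a b} z → a ≈ b → a + z ≈ b + z
  +-congʳ {a} {b} z a≈b = begin
    a + z             ≈⟨ %-distribˡ-+ a z n ⟩
    a % n + z % n     ≡⟨ cong (_+ z % n) a≈b ⟩
    b % n + z % n     ≈⟨ %-distribˡ-+ b z n ⟨
    b + z             ∎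

  +-congˡ : ∀ {a b} z → a ≈ b → z + a ≈ z + b
  +-congˡ {a} {b} z a≈b = begin
    z + a ≡⟨ +-comm z a ⟩
    a + z ≈⟨ +-congʳ z a≈b ⟩
    b + z ≡⟨ +-comm b z ⟩
    z + b ∎

  *-congʳ : ∀ {a b} z → a ≈ b → a * z ≈ b * z
  *-congʳ {a} {b} z a≈b = begin
    a * z             ≈⟨ %-distribˡ-* a z n ⟩
    a % n * (z % n)   ≡⟨ cong (_* (z % n)) a≈b ⟩
    b % n * (z % n)   ≈⟨ %-distribˡ-* b z n ⟨
    b * z             ∎

  *-congˡ : ∀ {a b} z → a ≈ b → z * a ≈ z * b
  *-congˡ {a} {b} z a≈b = begin
    z * a ≡⟨ *-comm z a ⟩
    a * z ≈⟨ *-congʳ z a≈b ⟩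
    b * z ≡⟨ *-comm b z ⟩
    z * b ∎

  -- Adding z * (n - 1) turns + z into + z * n ≈ + 0.
  +-cancelʳ : ∀ {a b} z → a + z ≈ b + z → a ≈ b
  +-cancelʳ {a} {b} z a+z≈b+z = begin
    a                      ≈⟨ [m+kn]%n≡m%n a z n ⟨
    a + z * n              ≡⟨ cong (a +_) z*n≡z+z*pn ⟩
    a + (z + z * pred n)   ≡⟨ +-assoc a z _ ⟨
    a + z + z * pred n     ≈⟨ +-congʳ (z * pred n) a+z≈b+z ⟩
    b + z + z * pred n     ≡⟨ +-assoc b z _ ⟩
    b + (z + z * pred n)   ≡⟨ cong (b +_) z*n≡z+z*pn ⟨
    b + z * n              ≈⟨ [m+kn]%n≡m%n b z n ⟩
    b                      ∎
    where
    z*n≡z+z*pn : z * n ≡ z + z * pred n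
    z*n≡z+z*pn = trans (cong (z *_) (sym (suc-pred n))) (*-suc z (pred n))

  *-cancelʳ-invertible : ∀ {a b m u} → m * u ≈ 1 → a * m ≈ b * m → a ≈ b
  *-cancelʳ-invertible {a} {b} {m} {u} m*u≈1 a*m≈b*m = begin
    a              ≡⟨ *-identityʳ a ⟨
    a * 1          ≈⟨ *-congˡ a m*u≈1 ⟨
    a * (m * u)    ≡⟨ *-assoc a m u ⟨
    a * m * u      ≈⟨ *-congʳ u a*m≈b*m ⟩
    b * m * u      ≡⟨ *-assoc b m u ⟩
    b * (m * u)    ≈⟨ *-congˡ b m*u≈1 ⟩
    b * 1          ≡⟨ *-identityʳ b ⟩
    b              ∎

  -- m + m' = n says m' ≡ −m, so c m' ≡ 1 gives c m ≡ −1.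
  c*m+1≈0 : ∀ {m m' c} → m + m' ≡ n → c * m' ≈ 1 → c * m + 1 ≈ 0
  c*m+1≈0 {m} {m'} {c} m+m'≡n c*m'≈1 = begin
    c * m + 1          ≈⟨ +-congˡ (c * m) c*m'≈1 ⟨
    c * m + c * m'     ≡⟨ *-distribˡ-+ c m m' ⟨
    c * (m + m')       ≡⟨ cong (c *_) m+m'≡n ⟩
    c * n              ≈⟨ *n≈0 c ⟩
    0                  ∎

  m*[n∸c]≈1 : ∀ {m c} → c ≤ n → c * m + 1 ≈ 0 → m * (n ∸ c) ≈ 1
  m*[n∸c]≈1 {m} {c} c≤n c*m+1≈0 = begin
    m * (n ∸ c)                  ≡⟨ +-identityʳ _ ⟨
    m * (n ∸ c) + 0              ≈⟨ +-congˡ (m * (n ∸ c)) c*m+1≈0 ⟨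
    m * (n ∸ c) + (c * m + 1)    ≡⟨ solve 3 (λ m d c → m :* d :+ (c :* m :+ con 1) := con 1 :+ m :* (d :+ c)) refl m (n ∸ c) c ⟩
    1 + m * (n ∸ c + c)          ≡⟨ cong (λ w → 1 + m * w) (m∸n+n≡m c≤n) ⟩
    1 + m * n                    ≈⟨ [m+kn]%n≡m%n 1 m n ⟩
    1                            ∎

module Word (n k : ℕ) .{{_ : NonZero n}} where

  open Modular n

  step : ℕ
  step = n ∸ k ∸ 1

  instance
    2*n≢0 : NonZero (2 * n)
    2*n≢0 = m*n≢0 2 n

    n*2≢0 : NonZero (n * 2)
    n*2≢0 = m*n≢0 n 2

  wordL-even : ∀ a → wordL n k (a * 2) ≡ E n (a * step + 1)
  wordL-even a rewrite m*n%n≡0 a 2 {{nonZero}} | m*n/n≡m a 2 {{nonZero}} = refl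

  wordL-odd : ∀ a → wordL n k (suc (a * 2)) ≡ E⁻¹ n (a * step)
  wordL-odd a rewrite [m+kn]%n≡m%n 1 a 2 {{nonZero}} | suc[m*2]/2≡m a = refl

  *2%[2*n] : ∀ a → (a * 2) % (2 * n) ≡ (a % n) * 2
  *2%[2*n] a = trans (%-congʳ (*-comm 2 n)) (sym (m%n*o≡m*o%[n*o] a n 2))

  suc*2%[2*n] : ∀ a → suc (a * 2) % (2 * n) ≡ suc ((a % n) * 2)
  suc*2%[2*n] a = begin
    suc (a * 2) % (2 * n)   ≡⟨ cong (_% (2 * n)) (+-comm 1 (a * 2)) ⟩
    (a * 2 + 1) % (2 * n)   ≡⟨ %-congʳ (*-comm 2 n) ⟩
    (a * 2 + 1) % (n * 2)   ≡⟨ [m*n+o]%[p*n]≡[m*n]%[p*n]+o a n (s≤s (s≤s z≤n)) ⟩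
    (a * 2) % (n * 2) + 1   ≡⟨ cong (_+ 1) (m%n*o≡m*o%[n*o] a n 2) ⟨
    (a % n) * 2 + 1         ≡⟨ +-comm _ 1 ⟩
    suc ((a % n) * 2)       ∎
    where open ≡-Reasoning

  wordL-even-cyclic : ∀ a → wordL n k ((a * 2) % (2 * n)) ≡ E n (a * step + 1)
  wordL-even-cyclic a rewrite *2%[2*n] a | wordL-even (a % n) =
    cong (true ,_) (+-congʳ 1 (*-congʳ step (%-≈ a)))

  wordL-odd-cyclic : ∀ a → wordL n k (suc (a * 2) % (2 * n)) ≡ E⁻¹ n (a * step)
  wordL-odd-cyclic a rewrite suc*2%[2*n] a | wordL-odd (a % n) =
    cong (false ,_) (*-congʳ step (%-≈ a))

  E⁻¹-position : ∀ {p i} → p < 2 * n → wordL n k p ≡ E⁻¹ n i →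
                 ∃ λ a → p ≡ suc (a * 2) × a < n × a * step ≈ i
  E⁻¹-position {p} p<2n w with evenOdd p
  ... | even a = contradiction (cong proj₁ (trans (sym (wordL-even a)) w)) λ ()
  ... | odd a  = a , refl , suc*2<*2⇒< (subst (suc (a * 2) <_) (*-comm 2 n) p<2n)
                   , cong proj₂ (trans (sym (wordL-odd a)) w)

  E-position : ∀ {q i} → q < 2 * n → wordL n k q ≡ E n i →
               ∃ λ b → q ≡ b * 2 × b < n × b * step + 1 ≈ i
  E-position {q} q<2n w with evenOdd q
  ... | odd b  = contradiction (cong proj₁ (trans (sym w) (wordL-odd b))) λ ()
  ... | even b = b , refl , *-cancelʳ-< 2 b n (subst (b * 2 <_) (*-comm 2 n) q<2n)
                   , cong proj₂ (trans (sym (wordL-even b)) w)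

InGap : (n k c i : ℕ) .{{_ : NonZero n}} → Letter → Set
InGap n k c i x = ∃ λ j → (1 ≤ j) × (j ≤ c ∸ 1)
  × ((x ≡ E n (i + j * (n ∸ k ∸ 1) + 1)) ⊎ (x ≡ E⁻¹ n (i + j * (n ∸ k ∸ 1))))

module Gap (n k c' : ℕ) .{{_ : NonZero n}} (k+2≤n : k + 2 ≤ n) (c<n : suc c' < n)
           (c*[k+1]%n≡1 : (suc c' * (k + 1)) % n ≡ 1) where

  open Modular n
  open Word n k

  c : ℕ
  c = suc c'

  step+[k+1]≡n : step + (k + 1) ≡ n
  step+[k+1]≡n = trans (cong (_+ (k + 1)) (∸-+-assoc n k 1)) (m∸n+n≡m k+1≤n)
    where
    k+1≤n : k + 1 ≤ n
    k+1≤n = ≤-trans (+-monoʳ-≤ k (s≤s z≤n)) k+2≤n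

  c*step+1≈0 : c * step + 1 ≈ 0
  c*step+1≈0 = c*m+1≈0 {step} {k + 1} {c} step+[k+1]≡n (trans c*[k+1]%n≡1 (sym (m<n⇒m%n≡m 1<n)))
    where
    1<n : 1 < n
    1<n = ≤-trans (m≤n+m 2 k) k+2≤n

  step*[n∸c]≈1 : step * (n ∸ c) ≈ 1
  step*[n∸c]≈1 = m*[n∸c]≈1 (<⇒≤ c<n) c*step+1≈0

  [a+c]*step+1≈a*step : ∀ a → (a + c) * step + 1 ≈ a * step
  [a+c]*step+1≈a*step a = begin
    (a + c) * step + 1       ≡⟨ solve 3 (λ a c s → (a :+ c) :* s :+ con 1 := a :* s :+ (c :* s :+ con 1)) refl a c step ⟩
    a * step + (c * step + 1) ≈⟨ +-congˡ (a * step) c*step+1≈0 ⟩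
    a * step + 0             ≡⟨ +-identityʳ _ ⟩
    a * step                 ∎
    where open ≈-Reasoning

  E⁻¹-index : ℕ → ℕ
  E⁻¹-index i = (i * (n ∸ c)) % n

  E⁻¹-index<n : ∀ i → E⁻¹-index i < n
  E⁻¹-index<n i = m%n<n _ n

  E⁻¹-index*step≈i : ∀ i → E⁻¹-index i * step ≈ i
  E⁻¹-index*step≈i i = begin
    E⁻¹-index i * step     ≈⟨ *-congʳ step (%-≈ (i * (n ∸ c))) ⟩
    i * (n ∸ c) * step     ≡⟨ solve 3 (λ i u s → i :* u :* s := i :* (s :* u)) refl i (n ∸ c) step ⟩
    i * (step * (n ∸ c))   ≈⟨ *-congˡ i step*[n∸c]≈1 ⟩
    i * 1                  ≡⟨ *-identityʳ i ⟩
    i                      ∎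
    where open ≈-Reasoning

  E-index : ∀ {a b i} → a * step ≈ i → b * step + 1 ≈ i → b < n → b ≡ (a + c) % n
  E-index {a} {b} {i} a*step≈i b*step+1≈i b<n =
    trans (sym (m<n⇒m%n≡m b<n)) (*-cancelʳ-invertible step*[n∸c]≈1 (+-cancelʳ 1 (begin
      b * step + 1         ≈⟨ b*step+1≈i ⟩
      i                    ≈⟨ a*step≈i ⟨
      a * step             ≈⟨ [a+c]*step+1≈a*step a ⟨
      (a + c) * step + 1   ∎)))
    where open ≈-Reasoning

  -- Q records whether shifting by c wraps around the end of the word.
  doubled-gap : ∀ {a b} Q → Q < 2 → a + c ≡ b + Q * n →
                b * 2 + 2 * n ≡ suc (a * 2) + suc (c' * 2) + (1 ∸ Q) * (2 * n)
  doubled-gap {a} {b} zero _ a+c≡b+0 = begin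
    b * 2 + 2 * n                           ≡⟨ cong (λ y → y * 2 + 2 * n) (trans (sym (+-identityʳ b)) (sym a+c≡b+0)) ⟩
    (a + c) * 2 + 2 * n                     ≡⟨ solve 3 (λ a c' n → (a :+ (con 1 :+ c')) :* con 2 :+ con 2 :* n
                                                              := con 1 :+ a :* con 2 :+ (con 1 :+ c' :* con 2) :+ con 1 :* (con 2 :* n)) refl a c' n ⟩
    suc (a * 2) + suc (c' * 2) + 1 * (2 * n) ∎
    where open ≡-Reasoning
  doubled-gap {a} {b} (suc zero) _ a+c≡b+n = begin
    b * 2 + 2 * n                           ≡⟨ solve 2 (λ b n → b :* con 2 :+ con 2 :* n := (b :+ con 1 :* n) :* con 2) refl b n ⟩
    (b + 1 * n) * 2                         ≡⟨ cong (_* 2) a+c≡b+n ⟨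
    (a + c) * 2                             ≡⟨ solve 2 (λ a c' → (a :+ (con 1 :+ c')) :* con 2
                                                              := con 1 :+ a :* con 2 :+ (con 1 :+ c' :* con 2) :+ con 0) refl a c' ⟩
    suc (a * 2) + suc (c' * 2) + 0 * (2 * n) ∎
    where open ≡-Reasoning
  doubled-gap (suc (suc _)) (s≤s (s≤s ())) _

  gap-length : ∀ {a b} → a < n → b ≡ (a + c) % n →
               (b * 2 + 2 * n ∸ suc (a * 2)) % (2 * n) ≡ suc (c' * 2)
  gap-length {a} {b} a<n b≡[a+c]%n =
    subst (λ y → (y ∸ suc (a * 2)) % (2 * n) ≡ suc (c' * 2))
      (sym (doubled-gap Q Q<2 a+c≡b+Q*n))
      ([m+n+o*p∸m]%p≡n (suc (a * 2)) (suc (c' * 2)) (1 ∸ Q) (2 * n) c*2∸1<2*n)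
    where
    Q : ℕ
    Q = (a + c) / n
    Q<2 : Q < 2
    Q<2 = m<n*o⇒m/o<n (subst (a + c <_) (cong (n +_) (sym (+-identityʳ n))) (+-mono-< a<n c<n))
    a+c≡b+Q*n : a + c ≡ b + Q * n
    a+c≡b+Q*n = trans (m≡m%n+[m/n]*n (a + c) n) (cong (_+ Q * n) (sym b≡[a+c]%n))
    c*2∸1<2*n : suc (c' * 2) < 2 * n
    c*2∸1<2*n = subst (suc (c' * 2) <_) (*-comm n 2) (*-monoˡ-≤ 2 (<⇒≤ c<n))

  letter-at-odd-offset : ∀ a {i} → a * step ≈ i → ∀ t →
    wordL n k ((suc (a * 2) + suc (t * 2)) % (2 * n)) ≡ E n (i + suc t * step + 1)
  letter-at-odd-offset a {i} a*step≈i t = begin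
    wordL n k ((suc (a * 2) + suc (t * 2)) % (2 * n)) ≡⟨ cong (λ y → wordL n k (y % (2 * n))) position ⟩
    wordL n k (((a + suc t) * 2) % (2 * n))          ≡⟨ wordL-even-cyclic (a + suc t) ⟩
    E n ((a + suc t) * step + 1)                      ≡⟨ cong (true ,_) index ⟩
    E n (i + suc t * step + 1)                        ∎
    where
    open ≡-Reasoning
    position : suc (a * 2) + suc (t * 2) ≡ (a + suc t) * 2
    position = solve 2 (λ a t → con 1 :+ a :* con 2 :+ (con 1 :+ t :* con 2) := (a :+ (con 1 :+ t)) :* con 2) refl a t
    index : (a + suc t) * step + 1 ≈ i + suc t * step + 1
    index = +-congʳ 1 (trans (cong (_% n) (*-distribʳ-+ step a (suc t))) (+-congʳ (suc t * step) a*step≈i))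

  letter-at-even-offset : ∀ a {i} → a * step ≈ i → ∀ t →
    wordL n k ((suc (a * 2) + suc t * 2) % (2 * n)) ≡ E⁻¹ n (i + suc t * step)
  letter-at-even-offset a {i} a*step≈i t = begin
    wordL n k ((suc (a * 2) + suc t * 2) % (2 * n)) ≡⟨ cong (λ y → wordL n k (y % (2 * n))) position ⟩
    wordL n k (suc ((a + suc t) * 2) % (2 * n))    ≡⟨ wordL-odd-cyclic (a + suc t) ⟩
    E⁻¹ n ((a + suc t) * step)                      ≡⟨ cong (false ,_) index ⟩
    E⁻¹ n (i + suc t * step)                        ∎
    where
    open ≡-Reasoning
    position : suc (a * 2) + suc t * 2 ≡ suc ((a + suc t) * 2)
    position = solve 2 (λ a t → con 1 :+ a :* con 2 :+ (con 1 :+ t) :* con 2 := con 1 :+ (a :+ (con 1 :+ t)) :* con 2) refl a t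
    index : (a + suc t) * step ≈ i + suc t * step
    index = trans (cong (_% n) (*-distribʳ-+ step a (suc t))) (+-congʳ (suc t * step) a*step≈i)

  module _ (a q : ℕ) {i} (a*step≈i : a * step ≈ i)
           (gap : (q + 2 * n ∸ suc (a * 2)) % (2 * n) ≡ suc (c' * 2)) where

    between⇒InGap : ∀ {x} → BetweenPos n k (suc (a * 2)) q x → InGap n k c i x
    between⇒InGap (d , 0<d , d<gap , w) with evenOdd d
    ... | even zero    = contradiction 0<d (n≮n 0)
    ... | even (suc t) = suc t , s≤s z≤n , *2<suc*2⇒≤ (subst (suc t * 2 <_) gap d<gap)
                           , inj₂ (trans (sym w) (letter-at-even-offset a a*step≈i t))
    ... | odd t        = suc t , s≤s z≤n , suc*2<suc*2⇒< (subst (suc (t * 2) <_) gap d<gap)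
                           , inj₁ (trans (sym w) (letter-at-odd-offset a a*step≈i t))

    InGap⇒between : ∀ {x} → InGap n k c i x → BetweenPos n k (suc (a * 2)) q x
    InGap⇒between (suc t , _ , t<c' , inj₁ refl) =
      suc (t * 2) , s≤s z≤n , subst (suc (t * 2) <_) (sym gap) (s≤s (*-monoˡ-< 2 t<c'))
      , letter-at-odd-offset a a*step≈i t
    InGap⇒between (suc t , _ , t<c' , inj₂ refl) =
      suc t * 2 , s≤s z≤n , subst (suc t * 2 <_) (sym gap) (s≤s (*-monoˡ-≤ 2 t<c'))
      , letter-at-even-offset a a*step≈i t

  E⁻¹-occurs : ∀ i → ∃ λ p → (p < 2 * n) × (wordL n k p ≡ E⁻¹ n i)
  E⁻¹-occurs i = suc (a * 2)
               , subst (suc (a * 2) <_) (*-comm n 2) (*-monoˡ-≤ 2 (E⁻¹-index<n i))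
               , trans (wordL-odd a) (cong (false ,_) (E⁻¹-index*step≈i i))
    where
    a : ℕ
    a = E⁻¹-index i

  E-occurs : ∀ i → ∃ λ q → (q < 2 * n) × (wordL n k q ≡ E n i)
  E-occurs i = b * 2
             , subst (b * 2 <_) (*-comm n 2) (*-monoˡ-< 2 (m%n<n _ n))
             , trans (wordL-even b) (cong (true ,_) b*step+1≈i)
    where
    a b : ℕ
    a = E⁻¹-index i
    b = (a + c) % n
    b*step+1≈i : b * step + 1 ≈ i
    b*step+1≈i = begin
      b * step + 1         ≈⟨ +-congʳ 1 (*-congʳ step (%-≈ (a + c))) ⟩
      (a + c) * step + 1   ≈⟨ [a+c]*step+1≈a*step a ⟩
      a * step             ≈⟨ E⁻¹-index*step≈i i ⟩
      i                    ∎
      where open ≈-Reasoning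

  between⇔InGap : ∀ i p q → p < 2 * n → q < 2 * n →
                  wordL n k p ≡ E⁻¹ n i → wordL n k q ≡ E n i →
                  ∀ x → BetweenPos n k p q x ⇔ InGap n k c i x
  between⇔InGap i p q p<2n q<2n wp wq x with E⁻¹-position p<2n wp | E-position q<2n wq
  ... | a , refl , a<n , a*step≈i | b , refl , b<n , b*step+1≈i =
    mk⇔ (between⇒InGap a (b * 2) a*step≈i gap) (InGap⇒between a (b * 2) a*step≈i gap)
    where
    gap : (b * 2 + 2 * n ∸ suc (a * 2)) % (2 * n) ≡ suc (c' * 2)
    gap = gap-length a<n (E-index a*step≈i b*step+1≈i b<n)

proposition3p4 : (n k c : ℕ) → .{{_ : NonZero n}}
    → 1 ≤ k → k + 2 ≤ n → gcd n (k * (k + 1)) ≡ 1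
    → 1 ≤ c → c < n → (c * (k + 1)) % n ≡ 1
    → (i : ℕ) → i < n
    → (∃ λ p → (p < 2 * n) × (wordL n k p ≡ E⁻¹ n i))
      × (∃ λ q → (q < 2 * n) × (wordL n k q ≡ E n i))
      × ((p q : ℕ) → p < 2 * n → q < 2 * n
         → wordL n k p ≡ E⁻¹ n i → wordL n k q ≡ E n i
         → (x : Letter)
         → BetweenPos n k p q x
           ⇔ (∃ λ j → (1 ≤ j) × (j ≤ c ∸ 1)
                × ((x ≡ E n (i + j * (n ∸ k ∸ 1) + 1))
                   ⊎ (x ≡ E⁻¹ n (i + j * (n ∸ k ∸ 1))))))
proposition3p4 n k zero _ _ _ () _ _ _ _
proposition3p4 n k (suc c') _ k+2≤n _ _ c<n c*[k+1]≡1 i _ =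
  E⁻¹-occurs i , E-occurs i , between⇔InGap i
  where open Gap n k c' k+2≤n c<n c*[k+1]≡1
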